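{- The graphs $G(\mathbb{Q}^2,2x^2+3y^2)$ and $G(\mathbb{Q}^3,2x^2+3y^2+3z^2)$ are empty, i.e. have no edges.
   Context: For a positive definite rational quadratic form $q$ in $n$ variables, $G(\mathbb{Q}^n,q)$ is the graph with vertex set $\mathbb{Q}^n$ in which $x,y$ are adjacent iff $q(x-y)=1$. -}

module Defs where

open import Data.Nat using (ℕ)
open import Data.Fin using (Fin; zero; suc)
open import Data.Rational using (ℚ; _+_; _*_; _-_; 1ℚ)
open import Relation.Binary.PropositionalEquality using (_≡_)
open import Relation.Nullary using (¬_)
open import Data.Integer using (+_)
import Data.Rational as ℚ

2ℚ 3ℚ : ℚ
2ℚ = ℚ._/_ (+ 2) 1
3ℚ = ℚ._/_ (+ 3) 1

Vecℚ : ℕ → Set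
Vecℚ n = Fin n → ℚ

QForm : ℕ → Set
QForm n = Vecℚ n → ℚ

_-ᵥ_ : ∀ {n} → Vecℚ n → Vecℚ n → Vecℚ n
(x -ᵥ y) i = x i - y i

Adjacent : ∀ {n} → QForm n → Vecℚ n → Vecℚ n → Set
Adjacent q x y = q (x -ᵥ y) ≡ 1ℚ

EdgeFree : ∀ {n} → QForm n → Set
EdgeFree {n} q = (x y : Vecℚ n) → ¬ Adjacent q x y

q₂ : QForm 2
q₂ v = (2ℚ * (v zero * v zero)) + (3ℚ * (v (suc zero) * v (suc zero)))

q₃ : QForm 3
q₃ v = ((2ℚ * (v zero * v zero)) + (3ℚ * (v (suc zero) * v (suc zero))))
       + (3ℚ * (v (suc (suc zero)) * v (suc (suc zero))))

-- Clearing denominators turns a rational point with 2x² + 3y² + 3z² = 1 into integers with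
-- 2a² + 3b² + 3c² = d² and d ≠ 0. Since −1 is not a square mod 3, a sum of two squares is
-- divisible by 3 only if both terms are; applied first to d² + a² = 3(a² + b² + c²) and then,
-- after writing a = 3a′ and d = 3d′, to b² + c² = 3(d′² − 2a′²), this shows that 3 divides
-- a, b, c and d, so (a/3, b/3, c/3, d/3) is a smaller solution. By descent d = 0.
module Submission where

open import Defs
open import Data.Nat using (ℕ; zero; suc; s≤s; z≤n; _+_; _*_; _<_; _%_; NonZero)
open import Data.Nat.Properties using (*-cancelˡ-≡; *-identityˡ; m<m*n)
open import Data.Nat.DivMod using (m%n<n; %-distribˡ-+; %-distribˡ-*)
open import Data.Nat.Divisibility using (_∣_; divides; divides-refl; m%n≡0⇒n∣m; n∣m⇒m%n≡0; m∣m*n; ∣m+n∣m⇒∣n)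
open import Data.Nat.Induction using (<-rec)
open import Data.Nat.Tactic.RingSolver using (solve)
open import Data.Integer as ℤ using (ℤ; +_; -[1+_])
open import Data.Integer.Properties using (+◃n≡+n; pos-+; pos-*)
import Data.Integer.Tactic.RingSolver as ℤ-Solver
open import Data.Rational as ℚ using (ℚ; 0ℚ; 1ℚ; toℚᵘ)
open import Data.Rational.Properties using (toℚᵘ-cong; toℚᵘ-homo-+; toℚᵘ-homo-*; +-identityʳ)
open import Data.Rational.Unnormalised as ℚᵘ using (ℚᵘ; mkℚᵘ; _≃_; _≄_; *≡*; 1ℚᵘ)
open import Data.Rational.Unnormalised.Properties using (module ≃-Reasoning; ≃-refl; ≃-trans; +-cong; *-congˡ)
open import Data.Fin.Patterns using (0F; 1F; 2F)
open import Data.List using (_∷_; [])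
open import Data.Product using (_×_; _,_; map)
open import Relation.Binary.PropositionalEquality using (_≡_; _≢_; refl; sym; trans; cong; cong₂; module ≡-Reasoning)

sum-of-squares-mod : ∀ m n d .{{_ : NonZero d}} →
                     (m * m + n * n) % d ≡ ((m % d) * (m % d) + (n % d) * (n % d)) % d
sum-of-squares-mod m n d = begin
  (m * m + n * n) % d                                  ≡⟨ %-distribˡ-+ (m * m) (n * n) d ⟩
  ((m * m) % d + (n * n) % d) % d                      ≡⟨ cong₂ (λ x y → (x + y) % d) (%-distribˡ-* m m d) (%-distribˡ-* n n d) ⟩
  ((m % d * (m % d)) % d + (n % d * (n % d)) % d) % d  ≡⟨ %-distribˡ-+ (m % d * (m % d)) (n % d * (n % d)) d ⟨
  (m % d * (m % d) + n % d * (n % d)) % d              ∎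
  where open ≡-Reasoning

residues-mod-3 : ∀ r s → r < 3 → s < 3 → (r * r + s * s) % 3 ≡ 0 → r ≡ 0 × s ≡ 0
residues-mod-3 0 0 _ _ _ = refl , refl
residues-mod-3 0 1 _ _ ()
residues-mod-3 0 2 _ _ ()
residues-mod-3 1 0 _ _ ()
residues-mod-3 1 1 _ _ ()
residues-mod-3 1 2 _ _ ()
residues-mod-3 2 0 _ _ ()
residues-mod-3 2 1 _ _ ()
residues-mod-3 2 2 _ _ ()
residues-mod-3 (suc (suc (suc _))) _ (s≤s (s≤s (s≤s ()))) _ _
residues-mod-3 _ (suc (suc (suc _))) _ (s≤s (s≤s (s≤s ()))) _

3∣m*m+n*n⇒3∣m×3∣n : ∀ m n → 3 ∣ m * m + n * n → 3 ∣ m × 3 ∣ n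
3∣m*m+n*n⇒3∣m×3∣n m n 3∣sum = map (m%n≡0⇒n∣m m 3) (m%n≡0⇒n∣m n 3)
  (residues-mod-3 (m % 3) (n % 3) (m%n<n m 3) (m%n<n n 3)
    (trans (sym (sum-of-squares-mod m n 3)) (n∣m⇒m%n≡0 _ 3 3∣sum)))

Solution : ℕ → ℕ → ℕ → ℕ → Set
Solution a b c d = 2 * (a * a) + 3 * (b * b) + 3 * (c * c) ≡ d * d

Solution⇒3∣d×3∣a : ∀ a b c d → Solution a b c d → 3 ∣ d × 3 ∣ a
Solution⇒3∣d×3∣a a b c d sol = 3∣m*m+n*n⇒3∣m×3∣n d a (divides (a * a + b * b + c * c) (begin
  d * d + a * a                                   ≡⟨ cong (_+ a * a) sol ⟨
  2 * (a * a) + 3 * (b * b) + 3 * (c * c) + a * a ≡⟨ solve (a ∷ b ∷ c ∷ []) ⟩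
  (a * a + b * b + c * c) * 3                     ∎))
  where open ≡-Reasoning

Solution⇒3∣b×3∣c : ∀ a b c d → Solution (a * 3) b c (d * 3) → 3 ∣ b × 3 ∣ c
Solution⇒3∣b×3∣c a b c d sol = 3∣m*m+n*n⇒3∣m×3∣n b c (∣m+n∣m⇒∣n 3∣sum (m∣m*n (2 * (a * a))))
  where
  open ≡-Reasoning
  3∣sum : 3 ∣ 3 * (2 * (a * a)) + (b * b + c * c)
  3∣sum = divides (d * d) (*-cancelˡ-≡ _ _ 3 (begin
    3 * (3 * (2 * (a * a)) + (b * b + c * c))         ≡⟨ solve (a ∷ b ∷ c ∷ []) ⟩
    2 * (a * 3 * (a * 3)) + 3 * (b * b) + 3 * (c * c) ≡⟨ sol ⟩
    d * 3 * (d * 3)                                   ≡⟨ solve (d ∷ []) ⟩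
    3 * (d * d * 3)                                   ∎))

Solution-÷3 : ∀ a b c d → Solution (a * 3) (b * 3) (c * 3) (d * 3) → Solution a b c d
Solution-÷3 a b c d sol = *-cancelˡ-≡ _ _ 9 (begin
  9 * (2 * (a * a) + 3 * (b * b) + 3 * (c * c))                         ≡⟨ solve (a ∷ b ∷ c ∷ []) ⟩
  2 * (a * 3 * (a * 3)) + 3 * (b * 3 * (b * 3)) + 3 * (c * 3 * (c * 3)) ≡⟨ sol ⟩
  d * 3 * (d * 3)                                                       ≡⟨ solve (d ∷ []) ⟩
  9 * (d * d)                                                           ∎)
  where open ≡-Reasoning

Solution⇒d≡0 : ∀ a b c d → Solution a b c d → d ≡ 0
Solution⇒d≡0 a b c d = <-rec (λ d → ∀ a b c → Solution a b c d → d ≡ 0) descent d a b c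
  where
  descent : ∀ d → (∀ {d′} → d′ < d → ∀ a b c → Solution a b c d′ → d′ ≡ 0) →
            ∀ a b c → Solution a b c d → d ≡ 0
  descent d smaller a b c sol with Solution⇒3∣d×3∣a a b c d sol
  ... | divides-refl d′ , divides-refl a′ with Solution⇒3∣b×3∣c a′ b c d′ sol
  ...   | divides-refl b′ , divides-refl c′ with d′ | Solution-÷3 a′ b′ c′ d′ sol
  ...     | zero  | _    = refl
  ...     | suc k | sol′ with () ← smaller (m<m*n (suc k) 3 (s≤s (s≤s z≤n))) a′ b′ c′ sol′

Solutionℤ : ℤ → ℤ → ℤ → ℤ → Set
Solutionℤ a b c d = + 2 ℤ.* (a ℤ.* a) ℤ.+ + 3 ℤ.* (b ℤ.* b) ℤ.+ + 3 ℤ.* (c ℤ.* c) ≡ d ℤ.* d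

i*i≡+∣i∣*∣i∣ : ∀ i → i ℤ.* i ≡ + (ℤ.∣ i ∣ * ℤ.∣ i ∣)
i*i≡+∣i∣*∣i∣ (+ n)    = +◃n≡+n (n * n)
i*i≡+∣i∣*∣i∣ -[1+ n ] = refl

Solutionℤ⇒Solution : ∀ a b c d → Solutionℤ a b c d → Solution (ℤ.∣ a ∣) (ℤ.∣ b ∣) (ℤ.∣ c ∣) (ℤ.∣ d ∣)
Solutionℤ⇒Solution a b c d sol = cong ℤ.∣_∣ (begin
  + (2 * ∣a∣² + 3 * ∣b∣² + 3 * ∣c∣²)
    ≡⟨ trans (pos-+ (2 * ∣a∣² + 3 * ∣b∣²) (3 * ∣c∣²))
             (cong₂ ℤ._+_ (trans (pos-+ (2 * ∣a∣²) (3 * ∣b∣²)) (cong₂ ℤ._+_ (pos-* 2 ∣a∣²) (pos-* 3 ∣b∣²)))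
                          (pos-* 3 ∣c∣²)) ⟩
  + 2 ℤ.* + ∣a∣² ℤ.+ + 3 ℤ.* + ∣b∣² ℤ.+ + 3 ℤ.* + ∣c∣²
    ≡⟨ cong₂ ℤ._+_ (cong₂ ℤ._+_ (cong (+ 2 ℤ.*_) (i*i≡+∣i∣*∣i∣ a)) (cong (+ 3 ℤ.*_) (i*i≡+∣i∣*∣i∣ b)))
                   (cong (+ 3 ℤ.*_) (i*i≡+∣i∣*∣i∣ c)) ⟨
  + 2 ℤ.* (a ℤ.* a) ℤ.+ + 3 ℤ.* (b ℤ.* b) ℤ.+ + 3 ℤ.* (c ℤ.* c)
    ≡⟨ sol ⟩
  d ℤ.* d
    ≡⟨ i*i≡+∣i∣*∣i∣ d ⟩
  + (ℤ.∣ d ∣ * ℤ.∣ d ∣) ∎)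
  where
  open ≡-Reasoning
  ∣a∣² ∣b∣² ∣c∣² : ℕ
  ∣a∣² = ℤ.∣ a ∣ * ℤ.∣ a ∣
  ∣b∣² = ℤ.∣ b ∣ * ℤ.∣ b ∣
  ∣c∣² = ℤ.∣ c ∣ * ℤ.∣ c ∣

-- The hypothesis is 2(a/M)² + 3(b/N)² + 3(c/K)² = 1, cross-multiplied as ℚᵘ's _≃_ does it.
clear-denominators : ∀ a b c M N K →
  ((+ 2 ℤ.* (a ℤ.* a) ℤ.* (N ℤ.* N) ℤ.+ + 3 ℤ.* (b ℤ.* b) ℤ.* (M ℤ.* M)) ℤ.* (K ℤ.* K)
     ℤ.+ + 3 ℤ.* (c ℤ.* c) ℤ.* (M ℤ.* M ℤ.* (N ℤ.* N))) ℤ.* + 1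
    ≡ + 1 ℤ.* (M ℤ.* M ℤ.* (N ℤ.* N) ℤ.* (K ℤ.* K)) →
  Solutionℤ (a ℤ.* N ℤ.* K) (b ℤ.* M ℤ.* K) (c ℤ.* M ℤ.* N) (M ℤ.* N ℤ.* K)
clear-denominators a b c M N K eq = begin
  + 2 ℤ.* (a ℤ.* N ℤ.* K ℤ.* (a ℤ.* N ℤ.* K)) ℤ.+ + 3 ℤ.* (b ℤ.* M ℤ.* K ℤ.* (b ℤ.* M ℤ.* K))
    ℤ.+ + 3 ℤ.* (c ℤ.* M ℤ.* N ℤ.* (c ℤ.* M ℤ.* N))                  ≡⟨ ℤ-Solver.solve (a ∷ b ∷ c ∷ M ∷ N ∷ K ∷ []) ⟩
  ((+ 2 ℤ.* (a ℤ.* a) ℤ.* (N ℤ.* N) ℤ.+ + 3 ℤ.* (b ℤ.* b) ℤ.* (M ℤ.* M)) ℤ.* (K ℤ.* K)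
     ℤ.+ + 3 ℤ.* (c ℤ.* c) ℤ.* (M ℤ.* M ℤ.* (N ℤ.* N))) ℤ.* + 1    ≡⟨ eq ⟩
  + 1 ℤ.* (M ℤ.* M ℤ.* (N ℤ.* N) ℤ.* (K ℤ.* K))                     ≡⟨ ℤ-Solver.solve (M ∷ N ∷ K ∷ []) ⟩
  M ℤ.* N ℤ.* K ℤ.* (M ℤ.* N ℤ.* K)                                 ∎
  where open ≡-Reasoning

ℚᵘ-form≃1⇒Solutionℤ : ∀ a b c m n k →
  let M = + suc m; N = + suc n; K = + suc k
      x = mkℚᵘ a m; y = mkℚᵘ b n; z = mkℚᵘ c k in
  + 2 ℚᵘ./ 1 ℚᵘ.* (x ℚᵘ.* x) ℚᵘ.+ + 3 ℚᵘ./ 1 ℚᵘ.* (y ℚᵘ.* y) ℚᵘ.+ + 3 ℚᵘ./ 1 ℚᵘ.* (z ℚᵘ.* z) ≃ 1ℚᵘ →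
  Solutionℤ (a ℤ.* N ℤ.* K) (b ℤ.* M ℤ.* K) (c ℤ.* M ℤ.* N) (M ℤ.* N ℤ.* K)
ℚᵘ-form≃1⇒Solutionℤ a b c m n k (*≡* eq) = clear-denominators a b c (+ suc m) (+ suc n) (+ suc k) (drop-units eq)
  where
  Cleared : ℕ → ℕ → ℕ → Set
  Cleared x y z = ((+ 2 ℤ.* (a ℤ.* a) ℤ.* + y ℤ.+ + 3 ℤ.* (b ℤ.* b) ℤ.* + x) ℤ.* + z
                    ℤ.+ + 3 ℤ.* (c ℤ.* c) ℤ.* (+ x ℤ.* + y)) ℤ.* + 1 ≡ + 1 ℤ.* + (x * y * z)
  -- The factors 1 are the denominators of the coefficients 2 and 3.
  drop-units : ∀ {x y z} → Cleared (1 * x) (1 * y) (1 * z) → Cleared x y z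
  drop-units {x} {y} {z} rewrite *-identityˡ x | *-identityˡ y | *-identityˡ z = λ cleared → cleared

ℚᵘ-form≄1 : ∀ x y z → (+ 2 ℚᵘ./ 1 ℚᵘ.* (x ℚᵘ.* x) ℚᵘ.+ + 3 ℚᵘ./ 1 ℚᵘ.* (y ℚᵘ.* y) ℚᵘ.+ + 3 ℚᵘ./ 1 ℚᵘ.* (z ℚᵘ.* z)) ≄ 1ℚᵘ
ℚᵘ-form≄1 (mkℚᵘ a m) (mkℚᵘ b n) (mkℚᵘ c k) eq
  = ∣W∣≢0 (Solution⇒d≡0 (ℤ.∣ P ∣) (ℤ.∣ Q ∣) (ℤ.∣ R ∣) (ℤ.∣ W ∣) (Solutionℤ⇒Solution P Q R W (ℚᵘ-form≃1⇒Solutionℤ a b c m n k eq)))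
  where
  M N K P Q R W : ℤ
  M = + suc m
  N = + suc n
  K = + suc k
  P = a ℤ.* N ℤ.* K
  Q = b ℤ.* M ℤ.* K
  R = c ℤ.* M ℤ.* N
  W = M ℤ.* N ℤ.* K
  ∣W∣≢0 : ℤ.∣ W ∣ ≢ 0
  ∣W∣≢0 ()

ℚ-form≢1 : ∀ x y z → 2ℚ ℚ.* (x ℚ.* x) ℚ.+ 3ℚ ℚ.* (y ℚ.* y) ℚ.+ 3ℚ ℚ.* (z ℚ.* z) ≢ 1ℚ
ℚ-form≢1 x y z eq = ℚᵘ-form≄1 (toℚᵘ x) (toℚᵘ y) (toℚᵘ z) (begin
  toℚᵘ 2ℚ ℚᵘ.* toℚᵘ² x ℚᵘ.+ toℚᵘ 3ℚ ℚᵘ.* toℚᵘ² y ℚᵘ.+ toℚᵘ 3ℚ ℚᵘ.* toℚᵘ² z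
    ≈⟨ +-cong (+-cong (homo-c*x² 2ℚ x) (homo-c*x² 3ℚ y)) (homo-c*x² 3ℚ z) ⟨
  toℚᵘ (2ℚ ℚ.* (x ℚ.* x)) ℚᵘ.+ toℚᵘ (3ℚ ℚ.* (y ℚ.* y)) ℚᵘ.+ toℚᵘ (3ℚ ℚ.* (z ℚ.* z))
    ≈⟨ +-cong (toℚᵘ-homo-+ (2ℚ ℚ.* (x ℚ.* x)) (3ℚ ℚ.* (y ℚ.* y))) ≃-refl ⟨
  toℚᵘ (2ℚ ℚ.* (x ℚ.* x) ℚ.+ 3ℚ ℚ.* (y ℚ.* y)) ℚᵘ.+ toℚᵘ (3ℚ ℚ.* (z ℚ.* z))
    ≈⟨ toℚᵘ-homo-+ (2ℚ ℚ.* (x ℚ.* x) ℚ.+ 3ℚ ℚ.* (y ℚ.* y)) (3ℚ ℚ.* (z ℚ.* z)) ⟨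
  toℚᵘ (2ℚ ℚ.* (x ℚ.* x) ℚ.+ 3ℚ ℚ.* (y ℚ.* y) ℚ.+ 3ℚ ℚ.* (z ℚ.* z))
    ≈⟨ toℚᵘ-cong eq ⟩
  1ℚᵘ ∎)
  where
  open ≃-Reasoning
  toℚᵘ² : ℚ → ℚᵘ
  toℚᵘ² w = toℚᵘ w ℚᵘ.* toℚᵘ w
  homo-c*x² : ∀ c w → toℚᵘ (c ℚ.* (w ℚ.* w)) ≃ toℚᵘ c ℚᵘ.* toℚᵘ² w
  homo-c*x² c w = ≃-trans (toℚᵘ-homo-* c (w ℚ.* w)) (*-congˡ {toℚᵘ c} (toℚᵘ-homo-* w w))

mainTheorem4 : EdgeFree q₂ × EdgeFree q₃
mainTheorem4 = (λ u v → q₂≢1 (u -ᵥ v)) , (λ u v → q₃≢1 (u -ᵥ v))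
  where
  q₃≢1 : ∀ v → q₃ v ≢ 1ℚ
  q₃≢1 v = ℚ-form≢1 (v 0F) (v 1F) (v 2F)
  -- 3ℚ ℚ.* (0ℚ ℚ.* 0ℚ) computes to 0ℚ, so q₂ is q₃ with last coordinate 0 up to +-identityʳ.
  q₂≢1 : ∀ v → q₂ v ≢ 1ℚ
  q₂≢1 v eq = ℚ-form≢1 (v 0F) (v 1F) 0ℚ (trans (+-identityʳ (q₂ v)) eq)
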